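{- Let $n\ge4$ and $m\le\lfloor n^2/4\rfloor$. If $G$ is a graph on $n$ vertices with $m$ edges such that $\theta(G)=\Theta_n(m)$, then $G$ is triangle-free.
   Context: All graphs are finite, simple and undirected. A clique cover of $G=(V,E)$ is a family of vertex sets, each inducing a clique, whose union is $V$ and such that every edge lies in some member. $\theta(G)$ is the minimum size of a clique cover of $G$. For $0\le m\le\binom n2$, $\Theta_n(m)$ is the maximum of $\theta(G)$ over all graphs $G$ with $n$ vertices and $m$ edges. -}

module Defs where

open import Data.Nat using (ℕ; _≤_; _<ᵇ_)
open import Data.Bool using (Bool; true; false; if_then_else_; _∧_)
open import Data.Fin using (Fin; toℕ)
open import Data.Fin.Subset using (Subset; _∈_)
open import Data.List using (List; length; map; allFin)
open import Data.Nat.ListAction using (sum)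
open import Data.List.Relation.Unary.All using (All)
open import Data.List.Relation.Unary.Any using (Any)
open import Data.Product using (Σ; _×_; ∃)
open import Relation.Binary.PropositionalEquality using (_≡_; _≢_)
open import Relation.Nullary using (¬_)

record Graph (n : ℕ) : Set where
  field
    adj    : Fin n → Fin n → Bool
    sym    : ∀ i j → adj i j ≡ adj j i
    irrefl : ∀ i → adj i i ≡ false
open Graph public

module _ {n : ℕ} (G : Graph n) where

  edgeCount : ℕ
  edgeCount = sum (map (λ i → sum (map (λ j →
      if (toℕ i <ᵇ toℕ j) ∧ adj G i j then 1 else 0) (allFin n))) (allFin n))

  IsClique : Subset n → Set
  IsClique S = ∀ i j → i ∈ S → j ∈ S → i ≢ j → adj G i j ≡ true

  IsCliqueCover : List (Subset n) → Set
  IsCliqueCover C =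
      All IsClique C
    × (∀ v → Any (λ S → v ∈ S) C)
    × (∀ i j → adj G i j ≡ true → Any (λ S → i ∈ S × j ∈ S) C)

  θ-is : ℕ → Set
  θ-is k =
      Σ (List (Subset n)) (λ C → IsCliqueCover C × length C ≡ k)
    × (∀ C → IsCliqueCover C → k ≤ length C)

  TriangleFree : Set
  TriangleFree = ∀ i j k →
    ¬ (adj G i j ≡ true × adj G j k ≡ true × adj G i k ≡ true)

-- If G is triangle-free, every clique of G is an edge or a single vertex: each edge and each
-- isolated vertex lies in a clique of any cover, and no clique contains two of them, so
-- θ(G) = e(G) + i(G), where i(G) counts isolated vertices.  If G contains a triangle,
-- covering it by one clique gives θ(G) ≤ e(G) + i(G) - 2, and the Erdős–Goodman–Pósa argument
-- (cover an edge xy and, for every other vertex w, the clique {w} ∪ (N(w) ∩ {x,y}), then recurse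
-- on the remaining vertices) gives θ(G) ≤ ⌊t²/4⌋ + i(G), where t = n - i(G) ≥ 3.  Conversely, if
-- r ≤ n and m ≤ ⌊r²/4⌋, a bipartite graph with m edges on r of the n vertices shows
-- Θₙ(m) ≥ m + n - r.  For the least such r the triangle bound forces r ≥ t + 2, and then
-- ⌊(r-1)²/4⌋ < m yields ⌊(r-1)²/4⌋ - (r-1) ≤ ⌊t²/4⌋ - t, contradicting the strict growth of
-- s ↦ ⌊s²/4⌋ - s for s ≥ 3.

module Submission where

open import Defs renaming (sym to adj-sym; irrefl to adj-irrefl)

open import Data.Nat.Properties hiding (_≟_)
import Algebra.Properties.CommutativeMonoid.Sum
open import Algebra.Properties.CommutativeSemigroup +-commutativeSemigroup using (xy∙z≈xz∙y)
open import Data.Bool using (Bool; true; false; if_then_else_; _∧_; _∨_; not)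
import Data.Bool as Bool
open import Data.Bool.Properties using (¬-not; ∨-comm; ∧-zeroʳ; ∨-identityʳ; not-involutive; not-¬)
open import Data.Fin using (Fin; zero; suc; toℕ; _≟_)
open import Data.Fin.Properties using (all?; ¬∀⟶∃¬; toℕ-injective)
import Data.Fin.Properties as Finₚ
open import Data.Fin.Subset using (Subset; _∈_; ⁅_⁆; _∪_; _∩_)
open import Data.Fin.Subset.Properties
  using (x∈⁅x⁆; x∈⁅y⁆⇒x≡y; x∈p∪q⁺; x∈p∪q⁻; x∈p∩q⁺; x∈p∩q⁻; _∈?_)
open import Data.List using (List; []; _∷_; length; map; allFin; filter; concatMap; tabulate; lookup; _++_)
open import Data.List.Properties using (length-++; length-map; map-cong; length-tabulate; filter-notAll)
open import Data.List.Membership.Propositional using (find; lose) renaming (_∈_ to _∈ₗ_)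
open import Data.List.Membership.Propositional.Properties using (∈-filter⁺; ∈-allFin; ∈-lookup)
open import Data.List.Relation.Unary.All using (All; []; _∷_)
import Data.List.Relation.Unary.All as All
import Data.List.Relation.Unary.All.Properties as Allₚ
open import Data.List.Relation.Unary.Any using (Any; here; there; any?)
import Data.List.Relation.Unary.Any as Any
import Data.List.Relation.Unary.Any.Properties as Anyₚ
open import Data.Nat using (ℕ; zero; suc; _≤_; _<_; _+_; _*_; _∸_; _/_; _⊓_; _<ᵇ_; _≤?_; _<?_;
                            z≤n; s≤s; s≤s⁻¹; ⌊_/2⌋; ⌈_/2⌉)
open import Data.Nat.DivMod using (m/n*n≤m)
open import Data.Nat.ListAction using (sum)
open import Data.Nat.Tactic.RingSolver using (solve-∀)
open import Data.Product using (∃; _×_; _,_; proj₁; proj₂; swap)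
open import Data.Sum using (_⊎_; inj₁; inj₂; [_,_]′)
import Data.Vec as Vec
import Data.Vec.Properties as Vecₚ
open import Function using (_∘_; case_of_)
open import Relation.Binary.Definitions using (tri<; tri≈; tri>)
open import Relation.Binary.PropositionalEquality
  using (_≡_; _≢_; refl; sym; trans; cong; cong₂; subst; module ≡-Reasoning)
open import Relation.Nullary using (¬_; Dec; yes; no; does; contradiction; ¬?; _×-dec_)
open import Relation.Nullary.Decidable using (dec-true; dec-false)
open import Relation.Nullary.Reflects using (ofʸ; ofⁿ)

module ∑ℕ = Algebra.Properties.CommutativeMonoid.Sum +-0-commutativeMonoid
open ∑ℕ using (sum-syntax; ∑-distrib-+; ∑-comm; sum-cong-≗) renaming (sum to ∑)

[_] : Bool → ℕ
[ b ] = if b then 1 else 0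

[b]≤1 : ∀ b → [ b ] ≤ 1
[b]≤1 true  = s≤s z≤n
[b]≤1 false = z≤n

[∧not]+[∧] : ∀ p q → [ p ∧ not q ] + [ p ∧ q ] ≡ [ p ]
[∧not]+[∧] true  true  = refl
[∧not]+[∧] true  false = refl
[∧not]+[∧] false _     = refl

[does]≡1 : ∀ {P : Set} (P? : Dec P) → P → [ does P? ] ≡ 1
[does]≡1 (yes _) _ = refl
[does]≡1 (no ¬p) p = contradiction p ¬p

[does]-witness : ∀ {P : Set} (P? : Dec P) → 0 < [ does P? ] → P
[does]-witness (yes p) _ = p

+-positive : ∀ {a b} → 0 < a + b → 0 < a ⊎ 0 < b
+-positive {zero}  b>0 = inj₂ b>0
+-positive {suc _} _   = inj₁ (s≤s z≤n)

+-≤1 : ∀ {a b} → a ≤ 1 → b ≤ 1 → (0 < a → ¬ 0 < b) → a + b ≤ 1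
+-≤1 {zero}                    _ b≤1 _    = b≤1
+-≤1 {suc zero}    {zero}      _ _   _    = ≤-refl
+-≤1 {suc zero}    {suc _}     _ _   excl = contradiction (s≤s z≤n) (excl (s≤s z≤n))
+-≤1 {suc (suc _)} (s≤s ())

⊓+∸⊓ : ∀ q m s → q ⊓ m + (m ∸ q) ⊓ s ≡ m ⊓ (q + s)
⊓+∸⊓ q m s with ≤-total m q
... | inj₁ m≤q = begin
  q ⊓ m + (m ∸ q) ⊓ s   ≡⟨ cong₂ _+_ (m≥n⇒m⊓n≡n m≤q) (cong (_⊓ s) (m≤n⇒m∸n≡0 m≤q)) ⟩
  m + 0                 ≡⟨ +-identityʳ m ⟩
  m                     ≡⟨ m≤n⇒m⊓n≡m (≤-trans m≤q (m≤m+n q s)) ⟨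
  m ⊓ (q + s)           ∎
  where open ≡-Reasoning
... | inj₂ q≤m with r , refl ← m≤n⇒∃[o]m+o≡n q≤m = begin
  q ⊓ (q + r) + (q + r ∸ q) ⊓ s  ≡⟨ cong₂ _+_ (m≤n⇒m⊓n≡m (m≤m+n q r))
                                             (cong (_⊓ s) (m+n∸m≡n q r)) ⟩
  q + r ⊓ s                      ≡⟨ +-distribˡ-⊓ q r s ⟩
  (q + r) ⊓ (q + s)              ∎
  where open ≡-Reasoning

∑-mono-≤ : ∀ {n} {f g : Fin n → ℕ} → (∀ i → f i ≤ g i) → ∑ f ≤ ∑ g
∑-mono-≤ {zero}  _   = z≤n
∑-mono-≤ {suc n} f≤g = +-mono-≤ (f≤g zero) (∑-mono-≤ (f≤g ∘ suc))

∑-1 : ∀ n → ∑[ i < n ] 1 ≡ n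
∑-1 zero    = refl
∑-1 (suc n) = cong suc (∑-1 n)

∑-≤0 : ∀ {n} {f : Fin n → ℕ} → (∀ i → f i ≤ 0) → ∑ f ≤ 0
∑-≤0 {n} f≤0 = ≤-trans (∑-mono-≤ f≤0) (≤-reflexive (∑ℕ.sum-replicate-zero n))

∑-≥-term : ∀ {n} (f : Fin n → ℕ) i → f i ≤ ∑ f
∑-≥-term f zero    = m≤m+n _ _
∑-≥-term f (suc i) = ≤-trans (∑-≥-term (f ∘ suc) i) (m≤n+m _ _)

∑-≥-pair : ∀ {n} (f : Fin n → ℕ) {i j} → i ≢ j → f i + f j ≤ ∑ f
∑-≥-pair f {zero}  {zero}  i≢j = contradiction refl i≢j
∑-≥-pair f {zero}  {suc j} _   = +-monoʳ-≤ (f zero) (∑-≥-term (f ∘ suc) j)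
∑-≥-pair f {suc i} {zero}  _   =
  subst (_≤ ∑ f) (+-comm (f zero) _) (+-monoʳ-≤ (f zero) (∑-≥-term (f ∘ suc) i))
∑-≥-pair f {suc i} {suc j} i≢j =
  ≤-trans (∑-≥-pair (f ∘ suc) (i≢j ∘ cong suc)) (m≤n+m _ _)

∑-≥-triple : ∀ {n} (f : Fin n → ℕ) {i j k} → i ≢ j → j ≢ k → i ≢ k →
             f i + f j + f k ≤ ∑ f
∑-≥-triple f {zero}  {zero}          i≢j _   _   = contradiction refl i≢j
∑-≥-triple f {zero}  {suc _} {zero}  _   _   i≢k = contradiction refl i≢k
∑-≥-triple f {suc _} {zero}  {zero}  _   j≢k _   = contradiction refl j≢k
∑-≥-triple f {zero}  {suc j} {suc k} _   j≢k _   =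
  subst (_≤ ∑ f) (sym (+-assoc (f zero) _ _))
    (+-monoʳ-≤ (f zero) (∑-≥-pair (f ∘ suc) (j≢k ∘ cong suc)))
∑-≥-triple f {suc i} {zero}  {suc k} _   _   i≢k =
  subst (_≤ ∑ f) (rotate (f zero) (f (suc i)) (f (suc k)))
    (+-monoʳ-≤ (f zero) (∑-≥-pair (f ∘ suc) (i≢k ∘ cong suc)))
  where
  rotate : ∀ a b c → a + (b + c) ≡ b + a + c
  rotate = solve-∀
∑-≥-triple f {suc i} {suc j} {zero}  i≢j _   _   =
  subst (_≤ ∑ f) (+-comm (f zero) _)
    (+-monoʳ-≤ (f zero) (∑-≥-pair (f ∘ suc) (i≢j ∘ cong suc)))
∑-≥-triple f {suc i} {suc j} {suc k} i≢j j≢k i≢k =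
  ≤-trans (∑-≥-triple (f ∘ suc) (i≢j ∘ cong suc) (j≢k ∘ cong suc) (i≢k ∘ cong suc))
          (m≤n+m _ _)

∑-positive : ∀ {n} (f : Fin n → ℕ) → 0 < ∑ f → ∃ λ i → 0 < f i
∑-positive {suc n} f ∑f>0 with 0 <? f zero
... | yes f₀>0 = zero , f₀>0
... | no  f₀≯0
  with i , fᵢ>0 ← ∑-positive (f ∘ suc)
                   (subst (λ x → 0 < x + ∑ (f ∘ suc)) (n≤0⇒n≡0 (≮⇒≥ f₀≯0)) ∑f>0)
  = suc i , fᵢ>0

∑-≤1 : ∀ {n} {f : Fin n → ℕ} → (∀ i → f i ≤ 1) →
       (∀ {i j} → 0 < f i → 0 < f j → i ≡ j) → ∑ f ≤ 1
∑-≤1 {zero}      _   _      = z≤n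
∑-≤1 {suc n} {f} f≤1 unique with 0 <? f zero
... | no  f₀≯0 =
  +-mono-≤ (≮⇒≥ f₀≯0) (∑-≤1 (f≤1 ∘ suc) (λ p q → Finₚ.suc-injective (unique p q)))
... | yes f₀>0 = ≤-trans (+-mono-≤ (f≤1 zero) (∑-≤0 rest≤0)) (≤-reflexive (+-identityʳ 1))
  where
  rest≤0 : ∀ i → f (suc i) ≤ 0
  rest≤0 i = ≮⇒≥ (λ fᵢ>0 → Finₚ.0≢1+n (unique f₀>0 fᵢ>0))

∑-below : ∀ {n} c → c ≤ n → ∑[ y < n ] [ toℕ y <ᵇ c ] ≡ c
∑-below {n}     zero    _         = ∑ℕ.sum-replicate-zero n
∑-below {suc n} (suc c) (s≤s c≤n) = cong suc (∑-below c c≤n)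

∑-interval : ∀ {n} a c → a + c ≤ n → ∑[ y < n ] [ not (toℕ y <ᵇ a) ∧ (toℕ y <ᵇ a + c) ] ≡ c
∑-interval         zero    c c≤n       = ∑-below c c≤n
∑-interval {suc n} (suc a) c (s≤s a+c≤n) = ∑-interval a c a+c≤n

∑-above+bound : ∀ {n} r → r ≤ n → ∑[ y < n ] [ not (toℕ y <ᵇ r) ] + r ≡ n
∑-above+bound {n}     zero    _         = trans (+-identityʳ _) (∑-1 n)
∑-above+bound {suc n} (suc r) (s≤s r≤n) = trans (+-suc _ r) (cong suc (∑-above+bound r r≤n))

∑-prefix : ∀ {n} p (f : ℕ → ℕ) → p ≤ n →
           ∑[ x < n ] (if toℕ x <ᵇ p then f (toℕ x) else 0) ≡ ∑[ x < p ] f (toℕ x)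
∑-prefix {n}     zero    f _         = ∑ℕ.sum-replicate-zero n
∑-prefix {suc n} (suc p) f (s≤s p≤n) = cong (f 0 +_) (∑-prefix p (f ∘ suc) p≤n)

[does]≤∑ : ∀ {K} {P : Set} {Q : Fin K → Set} (P? : Dec P) (Q? : ∀ k → Dec (Q k)) →
           (P → ∃ Q) → [ does P? ] ≤ ∑[ k < K ] [ does (P? ×-dec Q? k) ]
[does]≤∑ (no _)  Q? _     = z≤n
[does]≤∑ (yes p) Q? P⇒∃Q with k , qk ← P⇒∃Q p =
  subst (_≤ ∑[ k < _ ] [ does (yes p ×-dec Q? k) ]) ([does]≡1 (yes p ×-dec Q? k) (p , qk)) (∑-≥-term _ k)

sum-map-tabulate : ∀ {n} {A : Set} (f : A → ℕ) (g : Fin n → A) → sum (map f (tabulate g)) ≡ ∑ (f ∘ g)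
sum-map-tabulate {zero}  f g = refl
sum-map-tabulate {suc n} f g = cong (f (g zero) +_) (sum-map-tabulate f (g ∘ suc))

sum-map-allFin : ∀ {n} (f : Fin n → ℕ) → sum (map f (allFin n)) ≡ ∑ f
sum-map-allFin f = sum-map-tabulate f (λ i → i)

sum-map-allFin₂ : ∀ {n} (f : Fin n → Fin n → ℕ) →
  sum (map (λ i → sum (map (f i) (allFin n))) (allFin n)) ≡ ∑[ i < n ] ∑[ j < n ] f i j
sum-map-allFin₂ {n} f = trans (sum-map-allFin (λ i → sum (map (f i) (allFin n))))
                              (sum-cong-≗ {n} (λ i → sum-map-allFin (f i)))

length-concatMap : ∀ {A B : Set} (f : A → List B) xs → length (concatMap f xs) ≡ sum (map (length ∘ f) xs)
length-concatMap f []       = refl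
length-concatMap f (x ∷ xs) = trans (length-++ (f x)) (cong (length (f x) +_) (length-concatMap f xs))

length-filter≡sum : ∀ {A : Set} {P : A → Set} (P? : ∀ x → Dec (P x)) xs →
                    length (filter P? xs) ≡ sum (map (λ x → [ does (P? x) ]) xs)
length-filter≡sum P? []       = refl
length-filter≡sum P? (x ∷ xs) with does (P? x)
... | true  = cong suc (length-filter≡sum P? xs)
... | false = length-filter≡sum P? xs

length-filter-¬+length-filter : ∀ {A : Set} {P : A → Set} (P? : ∀ x → Dec (P x)) xs →
  length (filter (¬? ∘ P?) xs) + length (filter P? xs) ≡ length xs
length-filter-¬+length-filter P? []       = refl
length-filter-¬+length-filter P? (x ∷ xs) with does (P? x)
... | false = cong suc (length-filter-¬+length-filter P? xs)
... | true  = trans (+-suc _ _) (cong suc (length-filter-¬+length-filter P? xs))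

quarterSquare : ℕ → ℕ
quarterSquare r = ⌊ r /2⌋ * ⌈ r /2⌉

quarterSquare-suc : ∀ s → quarterSquare (suc s) ≡ quarterSquare s + ⌈ s /2⌉
quarterSquare-suc s = begin
  ⌈ s /2⌉ * suc ⌊ s /2⌋       ≡⟨ *-suc ⌈ s /2⌉ ⌊ s /2⌋ ⟩
  ⌈ s /2⌉ + ⌈ s /2⌉ * ⌊ s /2⌋ ≡⟨ +-comm ⌈ s /2⌉ _ ⟩
  ⌈ s /2⌉ * ⌊ s /2⌋ + ⌈ s /2⌉ ≡⟨ cong (_+ ⌈ s /2⌉) (*-comm ⌈ s /2⌉ ⌊ s /2⌋) ⟩
  quarterSquare s + ⌈ s /2⌉   ∎
  where open ≡-Reasoning

quarterSquare-suc-suc : ∀ s → quarterSquare (suc (suc s)) ≡ quarterSquare s + suc s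
quarterSquare-suc-suc s = begin
  suc ⌊ s /2⌋ * suc ⌈ s /2⌉               ≡⟨ expand ⌊ s /2⌋ ⌈ s /2⌉ ⟩
  quarterSquare s + suc (⌊ s /2⌋ + ⌈ s /2⌉)
    ≡⟨ cong (λ x → quarterSquare s + suc x) (⌊n/2⌋+⌈n/2⌉≡n s) ⟩
  quarterSquare s + suc s                 ∎
  where
  open ≡-Reasoning
  expand : ∀ a b → suc a * suc b ≡ a * b + suc (a + b)
  expand = solve-∀

quarterSquare-mono-≤ : ∀ {a b} → a ≤ b → quarterSquare a ≤ quarterSquare b
quarterSquare-mono-≤ a≤b = *-mono-≤ (⌊n/2⌋-mono a≤b) (⌈n/2⌉-mono a≤b)

square≤4*quarterSquare+1 : ∀ n → n * n ≤ 4 * quarterSquare n + 1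
square≤4*quarterSquare+1 zero          = z≤n
square≤4*quarterSquare+1 (suc zero)    = ≤-refl
square≤4*quarterSquare+1 (suc (suc s)) = begin
  suc (suc s) * suc (suc s)               ≡⟨ expand s ⟩
  s * s + 4 * suc s                       ≤⟨ +-monoˡ-≤ (4 * suc s) (square≤4*quarterSquare+1 s) ⟩
  4 * quarterSquare s + 1 + 4 * suc s     ≡⟨ regroup (quarterSquare s) s ⟩
  4 * (quarterSquare s + suc s) + 1       ≡⟨ cong (λ x → 4 * x + 1) (quarterSquare-suc-suc s) ⟨
  4 * quarterSquare (suc (suc s)) + 1     ∎
  where
  open ≤-Reasoning
  expand : ∀ s → suc (suc s) * suc (suc s) ≡ s * s + 4 * suc s
  expand = solve-∀
  regroup : ∀ q s → 4 * q + 1 + 4 * suc s ≡ 4 * (q + suc s) + 1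
  regroup = solve-∀

≤⌊square/4⌋⇒≤quarterSquare : ∀ {m} n → m ≤ (n * n) / 4 → m ≤ quarterSquare n
≤⌊square/4⌋⇒≤quarterSquare {m} n m≤ = s≤s⁻¹ (*-cancelˡ-< 4 m (suc (quarterSquare n)) (begin-strict
  4 * m                        ≡⟨ *-comm 4 m ⟩
  m * 4                        ≤⟨ *-monoˡ-≤ 4 m≤ ⟩
  (n * n) / 4 * 4              ≤⟨ m/n*n≤m (n * n) 4 ⟩
  n * n                        ≤⟨ square≤4*quarterSquare+1 n ⟩
  4 * quarterSquare n + 1      <⟨ +-monoʳ-< (4 * quarterSquare n) (s≤s (s≤s z≤n)) ⟩
  4 * quarterSquare n + 4      ≡⟨ +-comm (4 * quarterSquare n) 4 ⟩
  4 + 4 * quarterSquare n      ≡⟨ *-suc 4 (quarterSquare n) ⟨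
  4 * suc (quarterSquare n)    ∎))
  where open ≤-Reasoning

quarterSquare-outgrows : ∀ {t u} → 3 ≤ t → t < u → quarterSquare t + u < quarterSquare u + t
quarterSquare-outgrows {t} {suc u} 3≤t t<1+u with m<1+n⇒m<n∨m≡n t<1+u
... | inj₂ refl = begin-strict
  quarterSquare t + suc t              <⟨ +-monoʳ-< (quarterSquare t) (n<1+n (suc t)) ⟩
  quarterSquare t + (2 + t)            ≤⟨ +-monoʳ-≤ (quarterSquare t) (+-monoˡ-≤ t (⌈n/2⌉-mono 3≤t)) ⟩
  quarterSquare t + (⌈ t /2⌉ + t)      ≡⟨ +-assoc (quarterSquare t) ⌈ t /2⌉ t ⟨
  quarterSquare t + ⌈ t /2⌉ + t        ≡⟨ cong (_+ t) (quarterSquare-suc t) ⟨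
  quarterSquare (suc t) + t            ∎
  where open ≤-Reasoning
... | inj₁ t<u = begin-strict
  quarterSquare t + suc u              ≡⟨ +-suc (quarterSquare t) u ⟩
  suc (quarterSquare t + u)            ≤⟨ quarterSquare-outgrows 3≤t t<u ⟩
  quarterSquare u + t                  <⟨ +-monoˡ-< t (m<m+n (quarterSquare u) ⌈u/2⌉>0) ⟩
  quarterSquare u + ⌈ u /2⌉ + t        ≡⟨ cong (_+ t) (quarterSquare-suc u) ⟨
  quarterSquare (suc u) + t            ∎
  where
  open ≤-Reasoning
  ⌈u/2⌉>0 : 0 < ⌈ u /2⌉
  ⌈u/2⌉>0 = ⌈n/2⌉-mono (≤-trans (s≤s z≤n) t<u)

least-above-quarterSquare : ∀ {m} n → m ≤ quarterSquare n →
  ∃ λ r → r ≤ n × m ≤ quarterSquare r × (∀ {u} → u < r → quarterSquare u < m)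
least-above-quarterSquare zero m≤ = 0 , z≤n , m≤ , λ ()
least-above-quarterSquare {m} (suc n) m≤ with m ≤? quarterSquare n
... | yes m≤Qn = let r , r≤n , m≤Qr , below = least-above-quarterSquare n m≤Qn
                 in r , m≤n⇒m≤1+n r≤n , m≤Qr , below
... | no  m≰Qn = suc n , ≤-refl , m≤ ,
                 λ u<1+n → ≤-<-trans (quarterSquare-mono-≤ (s≤s⁻¹ u<1+n)) (≰⇒> m≰Qn)

module _ {n : ℕ} where

  i∈⁅i⁆∪⁅j⁆ : ∀ {i j : Fin n} → i ∈ ⁅ i ⁆ ∪ ⁅ j ⁆
  i∈⁅i⁆∪⁅j⁆ {i} = x∈p∪q⁺ (inj₁ (x∈⁅x⁆ i))

  j∈⁅i⁆∪⁅j⁆ : ∀ {i j : Fin n} → j ∈ ⁅ i ⁆ ∪ ⁅ j ⁆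
  j∈⁅i⁆∪⁅j⁆ {j = j} = x∈p∪q⁺ (inj₂ (x∈⁅x⁆ j))

  ∈⁅i⁆∪⁅j⁆⁻ : ∀ {x : Fin n} i j → x ∈ ⁅ i ⁆ ∪ ⁅ j ⁆ → x ≡ i ⊎ x ≡ j
  ∈⁅i⁆∪⁅j⁆⁻ i j x∈ with x∈p∪q⁻ ⁅ i ⁆ ⁅ j ⁆ x∈
  ... | inj₁ x∈⁅i⁆ = inj₁ (x∈⁅y⁆⇒x≡y i x∈⁅i⁆)
  ... | inj₂ x∈⁅j⁆ = inj₂ (x∈⁅y⁆⇒x≡y j x∈⁅j⁆)

  pairs : {P : Fin n → Fin n → Set} → (∀ i j → Dec (P i j)) → List (Subset n)
  pairs P? = concatMap (λ i → map (λ j → ⁅ i ⁆ ∪ ⁅ j ⁆) (filter (P? i) (allFin n))) (allFin n)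

  module _ {P : Fin n → Fin n → Set} (P? : ∀ i j → Dec (P i j)) where

    length-pairs : length (pairs P?) ≡ ∑[ i < n ] ∑[ j < n ] [ does (P? i j) ]
    length-pairs = begin
      length (pairs P?)                                                  ≡⟨ length-concatMap _ (allFin n) ⟩
      sum (map (λ i → length (map (λ j → ⁅ i ⁆ ∪ ⁅ j ⁆) (filter (P? i) (allFin n)))) (allFin n))
        ≡⟨ cong sum (map-cong (λ i → trans (length-map _ (filter (P? i) (allFin n)))
                                            (length-filter≡sum (P? i) (allFin n))) (allFin n)) ⟩
      sum (map (λ i → sum (map (λ j → [ does (P? i j) ]) (allFin n))) (allFin n))
        ≡⟨ sum-map-allFin₂ (λ i j → [ does (P? i j) ]) ⟩
      ∑[ i < n ] ∑[ j < n ] [ does (P? i j) ]                            ∎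
      where open ≡-Reasoning

    pairs⁺ : ∀ {i j} → P i j → Any (λ S → i ∈ S × j ∈ S) (pairs P?)
    pairs⁺ {i} {j} pij = Anyₚ.concat⁺ (Anyₚ.map⁺ (Anyₚ.tabulate⁺ i
      (Anyₚ.map⁺ (Any.map (λ { refl → i∈⁅i⁆∪⁅j⁆ , j∈⁅i⁆∪⁅j⁆ })
                          (∈-filter⁺ (P? i) (∈-allFin j) pij)))))

    All-pairs : ∀ {Q : Subset n → Set} → (∀ {i j} → P i j → Q (⁅ i ⁆ ∪ ⁅ j ⁆)) → All Q (pairs P?)
    All-pairs q = Allₚ.concat⁺ (Allₚ.map⁺ (Allₚ.tabulate⁺ λ i →
      Allₚ.map⁺ (All.map q (Allₚ.all-filter (P? i) (allFin n)))))

module _ {n : ℕ} (G : Graph n) where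

  Covered : List (Subset n) → Fin n → Fin n → Set
  Covered C i j = Any (λ S → i ∈ S × j ∈ S) C

  CoversEdges : List (Subset n) → Set
  CoversEdges C = ∀ {i j} → adj G i j ≡ true → Covered C i j

  CliqueCoverable : ℕ → Set
  CliqueCoverable L = ∃ λ C → IsCliqueCover G C × length C ≤ L

  θ-is⇒≤ : ∀ {k L} → θ-is G k → CliqueCoverable L → k ≤ L
  θ-is⇒≤ (_ , minimal) (C , cover , |C|≤L) = ≤-trans (minimal C cover) |C|≤L

  adj-flip : ∀ {i j} → adj G i j ≡ true → adj G j i ≡ true
  adj-flip {i} {j} e = trans (adj-sym G j i) e

  adj⇒≢ : ∀ {i j} → adj G i j ≡ true → i ≢ j
  adj⇒≢ {i} e refl = contradiction (trans (sym e) (adj-irrefl G i)) λ ()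

  ⁅⁆-isClique : ∀ v → IsClique G ⁅ v ⁆
  ⁅⁆-isClique v x y x∈ y∈ x≢y =
    contradiction (trans (x∈⁅y⁆⇒x≡y v x∈) (sym (x∈⁅y⁆⇒x≡y v y∈))) x≢y

  ∩-isClique : ∀ {S} T → IsClique G S → IsClique G (S ∩ T)
  ∩-isClique T cl x y x∈ y∈ = cl x y (proj₁ (x∈p∩q⁻ _ T x∈)) (proj₁ (x∈p∩q⁻ _ T y∈))

  ∪⁅⁆-isClique : ∀ {S v} → IsClique G S → (∀ {x} → x ∈ S → x ≢ v → adj G x v ≡ true) →
                 IsClique G (S ∪ ⁅ v ⁆)
  ∪⁅⁆-isClique {S} {v} cl toV x y x∈ y∈ x≢y with x∈p∪q⁻ S ⁅ v ⁆ x∈ | x∈p∪q⁻ S ⁅ v ⁆ y∈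
  ... | inj₁ x∈S | inj₁ y∈S = cl x y x∈S y∈S x≢y
  ... | inj₁ x∈S | inj₂ y∈v with refl ← x∈⁅y⁆⇒x≡y v y∈v = toV x∈S x≢y
  ... | inj₂ x∈v | inj₁ y∈S with refl ← x∈⁅y⁆⇒x≡y v x∈v = adj-flip (toV y∈S (x≢y ∘ sym))
  ... | inj₂ x∈v | inj₂ y∈v =
    contradiction (trans (x∈⁅y⁆⇒x≡y v x∈v) (sym (x∈⁅y⁆⇒x≡y v y∈v))) x≢y

  ⁅i⁆∪⁅j⁆-isClique : ∀ {i j} → adj G i j ≡ true → IsClique G (⁅ i ⁆ ∪ ⁅ j ⁆)
  ⁅i⁆∪⁅j⁆-isClique {i} e = ∪⁅⁆-isClique (⁅⁆-isClique i)
    λ x∈ _ → subst (λ x → adj G x _ ≡ true) (sym (x∈⁅y⁆⇒x≡y i x∈)) e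

  Isolated : Fin n → Set
  Isolated v = ∀ j → adj G v j ≡ false

  isolated? : ∀ v → Dec (Isolated v)
  isolated? v = all? (λ j → adj G v j Bool.≟ false)

  adj⇒¬isolated : ∀ {v j} → adj G v j ≡ true → ¬ Isolated v
  adj⇒¬isolated {v} {j} e iso = contradiction (trans (sym e) (iso j)) λ ()

  ¬isolated⇒adj : ∀ {v} → ¬ Isolated v → ∃ λ j → adj G v j ≡ true
  ¬isolated⇒adj {v} ¬iso with ¬∀⟶∃¬ n _ (λ j → adj G v j Bool.≟ false) ¬iso
  ... | j , ≢false = j , ¬-not ≢false

  isolatedVertices nonIsolatedVertices : List (Fin n)
  isolatedVertices    = filter isolated? (allFin n)
  nonIsolatedVertices = filter (¬? ∘ isolated?) (allFin n)

  isolatedCount nonIsolatedCount : ℕ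
  isolatedCount    = length isolatedVertices
  nonIsolatedCount = length nonIsolatedVertices

  nonIsolatedCount+isolatedCount : nonIsolatedCount + isolatedCount ≡ n
  nonIsolatedCount+isolatedCount =
    trans (length-filter-¬+length-filter isolated? (allFin n)) (length-tabulate (λ i → i))

  isolatedCount≡∑ : isolatedCount ≡ ∑[ v < n ] [ does (isolated? v) ]
  isolatedCount≡∑ = trans (length-filter≡sum isolated? (allFin n))
                          (sum-map-allFin (λ v → [ does (isolated? v) ]))

  isolatedSingletons : List (Subset n)
  isolatedSingletons = map ⁅_⁆ isolatedVertices

  isCliqueCover-++isolated : ∀ {C} → All (IsClique G) C → CoversEdges C →
                             IsCliqueCover G (C ++ isolatedSingletons)
  isCliqueCover-++isolated {C} cliques covers =
    Allₚ.++⁺ cliques (Allₚ.map⁺ (All.universal ⁅⁆-isClique _)) ,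
    coversVertex ,
    λ i j e → Anyₚ.++⁺ˡ (covers e)
    where
    coversVertex : ∀ v → Any (v ∈_) (C ++ isolatedSingletons)
    coversVertex v with isolated? v
    ... | yes iso = Anyₚ.++⁺ʳ C (Anyₚ.map⁺ (Any.map (λ { refl → x∈⁅x⁆ v })
                                                   (∈-filter⁺ isolated? (∈-allFin v) iso)))
    ... | no ¬iso = Anyₚ.++⁺ˡ (Any.map proj₁ (covers (proj₂ (¬isolated⇒adj ¬iso))))

  coverable-++isolated : ∀ {C L} → All (IsClique G) C → CoversEdges C → length C ≤ L →
                         CliqueCoverable (L + isolatedCount)
  coverable-++isolated {C} cliques covers |C|≤L =
    C ++ isolatedSingletons , isCliqueCover-++isolated cliques covers ,
    ≤-trans (≤-reflexive (trans (length-++ C) (cong (length C +_) (length-map ⁅_⁆ isolatedVertices))))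
            (+-monoˡ-≤ isolatedCount |C|≤L)

  UpperEdge : Fin n → Fin n → Set
  UpperEdge i j = toℕ i < toℕ j × adj G i j ≡ true

  upperEdge? : ∀ i j → Dec (UpperEdge i j)
  upperEdge? i j = toℕ i <? toℕ j ×-dec adj G i j Bool.≟ true

  edgeCount≡∑upperEdge : edgeCount G ≡ ∑[ i < n ] ∑[ j < n ] [ does (upperEdge? i j) ]
  edgeCount≡∑upperEdge =
    trans (sum-map-allFin₂ (λ i j → [ (toℕ i <ᵇ toℕ j) ∧ adj G i j ]))
          (sum-cong-≗ {n} λ i → sum-cong-≗ {n} λ j →
             cong (λ b → [ (toℕ i <ᵇ toℕ j) ∧ b ]) (sym (does-≟true (adj G i j))))
    where
    does-≟true : ∀ b → does (b Bool.≟ true) ≡ b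
    does-≟true true  = refl
    does-≟true false = refl

  coversEdges-fromUpper : ∀ {C} → (∀ {i j} → UpperEdge i j → Covered C i j) → CoversEdges C
  coversEdges-fromUpper covers {i} {j} e with <-cmp (toℕ i) (toℕ j)
  ... | tri< i<j _ _ = covers (i<j , e)
  ... | tri≈ _ i≡j _ = contradiction (toℕ-injective i≡j) (adj⇒≢ e)
  ... | tri> _ _ j<i = Any.map swap (covers (j<i , adj-flip e))

  edgeCliques : List (Subset n)
  edgeCliques = pairs upperEdge?

  isCliqueCover-edgeCliques : IsCliqueCover G (edgeCliques ++ isolatedSingletons)
  isCliqueCover-edgeCliques = isCliqueCover-++isolated
    (All-pairs upperEdge? (⁅i⁆∪⁅j⁆-isClique ∘ proj₂)) (coversEdges-fromUpper (pairs⁺ upperEdge?))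

  length-edgeCliques : length (edgeCliques ++ isolatedSingletons) ≡ edgeCount G + isolatedCount
  length-edgeCliques = trans (length-++ edgeCliques)
    (cong₂ _+_ (trans (length-pairs upperEdge?) (sym edgeCount≡∑upperEdge)) (length-map ⁅_⁆ isolatedVertices))

  weight : Subset n → Fin n → ℕ
  weight S i = ∑[ j < n ] [ does (upperEdge? i j ×-dec (i ∈? S ×-dec j ∈? S)) ]
             + [ does (isolated? i ×-dec i ∈? S) ]

  weight-positive : ∀ {S i} → 0 < weight S i → i ∈ S × (Isolated i ⊎ ∃ λ j → UpperEdge i j × j ∈ S)
  weight-positive {S} {i} w>0 with +-positive w>0
  ... | inj₁ edges>0 = let j , term>0 = ∑-positive _ edges>0
                           up , i∈S , j∈S = [does]-witness (upperEdge? i j ×-dec (i ∈? S ×-dec j ∈? S)) term>0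
                       in i∈S , inj₂ (j , up , j∈S)
  ... | inj₂ iso>0   = let iso , i∈S = [does]-witness (isolated? i ×-dec i ∈? S) iso>0
                       in i∈S , inj₁ iso

  module _ (triangleFree : TriangleFree G) {S : Subset n} (clique : IsClique G S) where

    clique-atMostTwo : ∀ {x y z} → x ∈ S → y ∈ S → z ∈ S → x ≢ y → x ≢ z → y ≡ z
    clique-atMostTwo {x} {y} {z} x∈ y∈ z∈ x≢y x≢z with y ≟ z
    ... | yes y≡z = y≡z
    ... | no  y≢z = contradiction (clique x y x∈ y∈ x≢y , clique y z y∈ z∈ y≢z , clique x z x∈ z∈ x≢z)
                                  (triangleFree x y z)

    weight≤1 : ∀ i → weight S i ≤ 1
    weight≤1 i = +-≤1 (∑-≤1 (λ j → [b]≤1 _) upper-unique) ([b]≤1 _) edge⇒¬isolated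
      where
      term : Fin n → ℕ
      term j = [ does (upperEdge? i j ×-dec (i ∈? S ×-dec j ∈? S)) ]
      upper-unique : ∀ {j j′} → 0 < term j → 0 < term j′ → j ≡ j′
      upper-unique {j} {j′} t>0 t′>0
        with (_ , e) , i∈S , j∈S ← [does]-witness (upperEdge? i j ×-dec (i ∈? S ×-dec j ∈? S)) t>0
           | (_ , e′) , _ , j′∈S ← [does]-witness (upperEdge? i j′ ×-dec (i ∈? S ×-dec j′ ∈? S)) t′>0
        = clique-atMostTwo i∈S j∈S j′∈S (adj⇒≢ e) (adj⇒≢ e′)
      edge⇒¬isolated : 0 < ∑[ j < n ] term j → ¬ 0 < [ does (isolated? i ×-dec i ∈? S) ]
      edge⇒¬isolated edges>0 iso>0 with j , t>0 ← ∑-positive term edges>0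
        = adj⇒¬isolated (proj₂ (proj₁ ([does]-witness (upperEdge? i j ×-dec (i ∈? S ×-dec j ∈? S)) t>0)))
                        (proj₁ ([does]-witness (isolated? i ×-dec i ∈? S) iso>0))

    weight-unique : ∀ {i i′} → 0 < weight S i → 0 < weight S i′ → i ≡ i′
    weight-unique {i} {i′} w>0 w′>0 with i ≟ i′
    ... | yes i≡i′ = i≡i′
    ... | no  i≢i′ with weight-positive w>0 | weight-positive w′>0
    ...   | i∈S , inj₁ iso | i′∈S , _ =
      contradiction iso (adj⇒¬isolated (clique i i′ i∈S i′∈S i≢i′))
    ...   | i∈S , _ | i′∈S , inj₁ iso′ =
      contradiction iso′ (adj⇒¬isolated (clique i′ i i′∈S i∈S (i≢i′ ∘ sym)))
    ...   | i∈S , inj₂ (j , (i<j , e) , j∈S) | i′∈S , inj₂ (j′ , (i′<j′ , e′) , j′∈S)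
      with refl ← clique-atMostTwo i∈S i′∈S j∈S i≢i′ (adj⇒≢ e)
         | refl ← clique-atMostTwo i′∈S i∈S j′∈S (i≢i′ ∘ sym) (adj⇒≢ e′)
      = contradiction i′<j′ (<-asym i<j)

    ∑weight≤1 : ∑[ i < n ] weight S i ≤ 1
    ∑weight≤1 = ∑-≤1 weight≤1 weight-unique

  module _ (triangleFree : TriangleFree G) where

    length-cliqueCover≥ : ∀ {C} → IsCliqueCover G C → edgeCount G + isolatedCount ≤ length C
    length-cliqueCover≥ {C} (cliques , coversVertices , coversEdges) = begin
      edgeCount G + isolatedCount
        ≡⟨ cong₂ _+_ edgeCount≡∑upperEdge isolatedCount≡∑ ⟩
      ∑[ i < n ] ∑[ j < n ] [ does (upperEdge? i j) ] + ∑[ i < n ] [ does (isolated? i) ]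
        ≡⟨ ∑-distrib-+ (λ i → ∑[ j < n ] [ does (upperEdge? i j) ]) (λ i → [ does (isolated? i) ]) ⟨
      ∑[ i < n ] (∑[ j < n ] [ does (upperEdge? i j) ] + [ does (isolated? i) ])
        ≤⟨ ∑-mono-≤ (λ i → +-mono-≤ (edges≤ i) (isolated≤ i)) ⟩
      ∑[ i < n ] (∑[ k < K ] ∑[ j < n ] edgeTerm k i j + ∑[ k < K ] isoTerm k i)
        ≡⟨ sum-cong-≗ {n} (λ i → ∑-distrib-+ (λ k → ∑[ j < n ] edgeTerm k i j) (λ k → isoTerm k i)) ⟨
      ∑[ i < n ] ∑[ k < K ] weight (S k) i
        ≡⟨ ∑-comm (λ i k → weight (S k) i) ⟩
      ∑[ k < K ] ∑[ i < n ] weight (S k) i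
        ≤⟨ ∑-mono-≤ (λ k → ∑weight≤1 triangleFree (All.lookup cliques (∈-lookup k))) ⟩
      ∑[ k < K ] 1
        ≡⟨ ∑-1 K ⟩
      K ∎
      where
      open ≤-Reasoning
      K : ℕ
      K = length C
      S : Fin K → Subset n
      S = lookup C
      edgeTerm : Fin K → Fin n → Fin n → ℕ
      edgeTerm k i j = [ does (upperEdge? i j ×-dec (i ∈? S k ×-dec j ∈? S k)) ]
      isoTerm : Fin K → Fin n → ℕ
      isoTerm k i = [ does (isolated? i ×-dec i ∈? S k) ]
      inCover : ∀ {P : Subset n → Set} → Any P C → ∃ λ k → P (S k)
      inCover p = Any.index p , Anyₚ.lookup-index p
      edges≤ : ∀ i → ∑[ j < n ] [ does (upperEdge? i j) ] ≤ ∑[ k < K ] ∑[ j < n ] edgeTerm k i j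
      edges≤ i = begin
        ∑[ j < n ] [ does (upperEdge? i j) ]
          ≤⟨ ∑-mono-≤ (λ j → [does]≤∑ (upperEdge? i j) (λ k → i ∈? S k ×-dec j ∈? S k)
                                        (λ up → inCover (coversEdges i j (proj₂ up)))) ⟩
        ∑[ j < n ] ∑[ k < K ] edgeTerm k i j
          ≡⟨ ∑-comm (λ j k → edgeTerm k i j) ⟩
        ∑[ k < K ] ∑[ j < n ] edgeTerm k i j ∎
      isolated≤ : ∀ i → [ does (isolated? i) ] ≤ ∑[ k < K ] isoTerm k i
      isolated≤ i = [does]≤∑ (isolated? i) (λ k → i ∈? S k) (λ _ → inCover (coversVertices i))

    θ-triangleFree : θ-is G (edgeCount G + isolatedCount)
    θ-triangleFree = (edgeCliques ++ isolatedSingletons , isCliqueCover-edgeCliques , length-edgeCliques) ,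
                     λ C cover → length-cliqueCover≥ cover

  IsTriangle : Fin n → Fin n → Fin n → Set
  IsTriangle a b c = adj G a b ≡ true × adj G b c ≡ true × adj G a c ≡ true

  IsTriangle-swap₁₂ : ∀ {a b c} → IsTriangle a b c → IsTriangle b a c
  IsTriangle-swap₁₂ (ab , bc , ac) = adj-flip ab , ac , bc

  IsTriangle-swap₂₃ : ∀ {a b c} → IsTriangle a b c → IsTriangle a c b
  IsTriangle-swap₂₃ (ab , bc , ac) = ac , adj-flip bc , ab

  record SortedTriangle : Set where
    field
      {a b c}  : Fin n
      a<b      : toℕ a < toℕ b
      b<c      : toℕ b < toℕ c
      triangle : IsTriangle a b c

  sortTriangle : ∀ {i j k} → IsTriangle i j k → SortedTriangle
  sortTriangle {i} {j} {k} t@(ij , jk , ik)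
    with <-cmp (toℕ i) (toℕ j) | <-cmp (toℕ j) (toℕ k) | <-cmp (toℕ i) (toℕ k)
  ... | tri≈ _ i≡j _ | _ | _ = contradiction (toℕ-injective i≡j) (adj⇒≢ ij)
  ... | _ | tri≈ _ j≡k _ | _ = contradiction (toℕ-injective j≡k) (adj⇒≢ jk)
  ... | _ | _ | tri≈ _ i≡k _ = contradiction (toℕ-injective i≡k) (adj⇒≢ ik)
  ... | tri< i<j _ _ | tri< j<k _ _ | _            = record { a<b = i<j ; b<c = j<k ; triangle = t }
  ... | tri< i<j _ _ | tri> _ _ k<j | tri< i<k _ _ = record { a<b = i<k ; b<c = k<j ; triangle = IsTriangle-swap₂₃ t }
  ... | tri< i<j _ _ | tri> _ _ k<j | tri> _ _ k<i =
    record { a<b = k<i ; b<c = i<j ; triangle = IsTriangle-swap₁₂ (IsTriangle-swap₂₃ t) }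
  ... | tri> _ _ j<i | tri< j<k _ _ | tri< i<k _ _ = record { a<b = j<i ; b<c = i<k ; triangle = IsTriangle-swap₁₂ t }
  ... | tri> _ _ j<i | tri< j<k _ _ | tri> _ _ k<i =
    record { a<b = j<k ; b<c = k<i ; triangle = IsTriangle-swap₂₃ (IsTriangle-swap₁₂ t) }
  ... | tri> _ _ j<i | tri> _ _ k<j | _            =
    record { a<b = k<j ; b<c = j<i ; triangle = IsTriangle-swap₁₂ (IsTriangle-swap₂₃ (IsTriangle-swap₁₂ t)) }

  module _ (T : SortedTriangle) where
    open SortedTriangle T

    private
      ab : adj G a b ≡ true
      ab = proj₁ triangle
      bc : adj G b c ≡ true
      bc = proj₁ (proj₂ triangle)
      ac : adj G a c ≡ true
      ac = proj₂ (proj₂ triangle)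

      Δ : Subset n
      Δ = (⁅ a ⁆ ∪ ⁅ b ⁆) ∪ ⁅ c ⁆

      Δ-isClique : IsClique G Δ
      Δ-isClique = ∪⁅⁆-isClique (⁅i⁆∪⁅j⁆-isClique ab)
        λ x∈ _ → [ (λ { refl → ac }) , (λ { refl → bc }) ]′ (∈⁅i⁆∪⁅j⁆⁻ a b x∈)

      InΔ? : ∀ i j → Dec (i ∈ Δ × j ∈ Δ)
      InΔ? i j = i ∈? Δ ×-dec j ∈? Δ

      outside? : ∀ i j → Dec (UpperEdge i j × ¬ (i ∈ Δ × j ∈ Δ))
      outside? i j = upperEdge? i j ×-dec ¬? (InΔ? i j)

      inside : Fin n → Fin n → ℕ
      inside i j = [ does (upperEdge? i j ×-dec InΔ? i j) ]

      triangleCliques : List (Subset n)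
      triangleCliques = Δ ∷ pairs outside?

      triangleCliques-cliques : All (IsClique G) triangleCliques
      triangleCliques-cliques = Δ-isClique ∷ All-pairs outside? (⁅i⁆∪⁅j⁆-isClique ∘ proj₂ ∘ proj₁)

      triangleCliques-covers : CoversEdges triangleCliques
      triangleCliques-covers = coversEdges-fromUpper λ {i} {j} up → case InΔ? i j of λ where
        (yes i,j∈Δ) → here i,j∈Δ
        (no  i,j∉Δ) → there (pairs⁺ outside? (up , i,j∉Δ))

      3≤∑∑inside : 3 ≤ ∑[ i < n ] ∑[ j < n ] inside i j
      3≤∑∑inside = begin
        1 + 1 + 1
          ≡⟨ cong₂ _+_ (cong₂ _+_ (edge a<b ab a∈Δ b∈Δ) (edge (<-trans a<b b<c) ac a∈Δ c∈Δ))
                       (edge b<c bc b∈Δ c∈Δ) ⟨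
        inside a b + inside a c + inside b c
          ≤⟨ +-mono-≤ (∑-≥-pair (inside a) (<⇒≢ b<c ∘ cong toℕ)) (∑-≥-term (inside b) c) ⟩
        ∑[ j < n ] inside a j + ∑[ j < n ] inside b j
          ≤⟨ ∑-≥-pair (λ i → ∑[ j < n ] inside i j) (<⇒≢ a<b ∘ cong toℕ) ⟩
        ∑[ i < n ] ∑[ j < n ] inside i j
          ∎
        where
        open ≤-Reasoning
        a∈Δ : a ∈ Δ
        a∈Δ = x∈p∪q⁺ (inj₁ i∈⁅i⁆∪⁅j⁆)
        b∈Δ : b ∈ Δ
        b∈Δ = x∈p∪q⁺ (inj₁ j∈⁅i⁆∪⁅j⁆)
        c∈Δ : c ∈ Δ
        c∈Δ = x∈p∪q⁺ (inj₂ (x∈⁅x⁆ c))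
        edge : ∀ {i j} → toℕ i < toℕ j → adj G i j ≡ true → i ∈ Δ → j ∈ Δ → inside i j ≡ 1
        edge {i} {j} i<j e i∈ j∈ = [does]≡1 (upperEdge? i j ×-dec InΔ? i j) ((i<j , e) , i∈ , j∈)

      length-triangleCliques : length triangleCliques + 2 ≤ edgeCount G
      length-triangleCliques = begin
        length triangleCliques + 2                 ≡⟨ cong (λ x → suc x + 2) (length-pairs outside?) ⟩
        suc (∑∑ outsideTerm) + 2                   ≡⟨ +-suc (∑∑ outsideTerm) 2 ⟨
        ∑∑ outsideTerm + 3                         ≤⟨ +-monoʳ-≤ (∑∑ outsideTerm) 3≤∑∑inside ⟩
        ∑∑ outsideTerm + ∑∑ inside
          ≡⟨ ∑∑-distrib-+ ⟨
        ∑[ i < n ] ∑[ j < n ] (outsideTerm i j + inside i j)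
          ≡⟨ sum-cong-≗ {n} (λ i → sum-cong-≗ {n} λ j →
               [∧not]+[∧] (does (upperEdge? i j)) (does (InΔ? i j))) ⟩
        ∑[ i < n ] ∑[ j < n ] [ does (upperEdge? i j) ] ≡⟨ edgeCount≡∑upperEdge ⟨
        edgeCount G                                ∎
        where
        open ≤-Reasoning
        outsideTerm : Fin n → Fin n → ℕ
        outsideTerm i j = [ does (outside? i j) ]
        ∑∑ : (Fin n → Fin n → ℕ) → ℕ
        ∑∑ f = ∑[ i < n ] ∑[ j < n ] f i j
        ∑∑-distrib-+ : ∑∑ (λ i j → outsideTerm i j + inside i j) ≡ ∑∑ outsideTerm + ∑∑ inside
        ∑∑-distrib-+ = trans (sum-cong-≗ {n} (λ i → ∑-distrib-+ (outsideTerm i) (inside i)))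
                             (∑-distrib-+ (λ i → ∑[ j < n ] outsideTerm i j) (λ i → ∑[ j < n ] inside i j))

    θ+2≤edgeCount+isolatedCount : ∀ {k} → θ-is G k → k + 2 ≤ edgeCount G + isolatedCount
    θ+2≤edgeCount+isolatedCount {k} θ = begin
      k + 2                                        ≤⟨ +-monoˡ-≤ 2 (θ-is⇒≤ θ coverable) ⟩
      length triangleCliques + isolatedCount + 2   ≡⟨ xy∙z≈xz∙y (length triangleCliques) isolatedCount 2 ⟩
      length triangleCliques + 2 + isolatedCount   ≤⟨ +-monoˡ-≤ isolatedCount length-triangleCliques ⟩
      edgeCount G + isolatedCount                  ∎
      where
      open ≤-Reasoning
      coverable : CliqueCoverable (length triangleCliques + isolatedCount)
      coverable = coverable-++isolated triangleCliques-cliques triangleCliques-covers ≤-refl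

    3≤nonIsolatedCount : 3 ≤ nonIsolatedCount
    3≤nonIsolatedCount = begin
      1 + 1 + 1
        ≡⟨ cong₂ _+_ (cong₂ _+_ (active ab) (active (adj-flip ab))) (active (adj-flip ac)) ⟨
      term a + term b + term c
        ≤⟨ ∑-≥-triple term (<⇒≢ a<b ∘ cong toℕ) (<⇒≢ b<c ∘ cong toℕ) (<⇒≢ (<-trans a<b b<c) ∘ cong toℕ) ⟩
      ∑[ v < n ] term v
        ≡⟨ trans (length-filter≡sum (¬? ∘ isolated?) (allFin n)) (sum-map-allFin term) ⟨
      nonIsolatedCount
        ∎
      where
      open ≤-Reasoning
      term : Fin n → ℕ
      term v = [ does (¬? (isolated? v)) ]
      active : ∀ {v j} → adj G v j ≡ true → term v ≡ 1
      active {v} e = [does]≡1 (¬? (isolated? v)) (adj⇒¬isolated e)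

  neighbours : Fin n → Subset n
  neighbours w = Vec.tabulate (adj G w)

  ∈-neighbours⁺ : ∀ {w v} → adj G w v ≡ true → v ∈ neighbours w
  ∈-neighbours⁺ {w} {v} e = Vecₚ.lookup⇒[]= v _ (trans (Vecₚ.lookup∘tabulate (adj G w) v) e)

  ∈-neighbours⁻ : ∀ {w v} → v ∈ neighbours w → adj G w v ≡ true
  ∈-neighbours⁻ {w} {v} v∈ = trans (sym (Vecₚ.lookup∘tabulate (adj G w) v)) (Vecₚ.[]=⇒lookup v∈)

  CoversEdgesWithin : List (Fin n) → List (Subset n) → Set
  CoversEdgesWithin A C = ∀ {i j} → i ∈ₗ A → j ∈ₗ A → adj G i j ≡ true → Covered C i j

  module ErdősGoodmanPósaStep {x y : Fin n} (xy : adj G x y ≡ true) where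

    -- Together with ⁅ x ⁆ ∪ ⁅ y ⁆, the cliques star w (w ≠ x, y) cover every edge at x or y.
    star : Fin n → Subset n
    star w = ((⁅ x ⁆ ∪ ⁅ y ⁆) ∩ neighbours w) ∪ ⁅ w ⁆

    star-isClique : ∀ w → IsClique G (star w)
    star-isClique w = ∪⁅⁆-isClique (∩-isClique (neighbours w) (⁅i⁆∪⁅j⁆-isClique xy))
                                   λ v∈ _ → adj-flip (∈-neighbours⁻ (proj₂ (x∈p∩q⁻ _ (neighbours w) v∈)))

    Endpoint : Fin n → Set
    Endpoint u = u ≡ x ⊎ u ≡ y

    endpoint∈⁅x⁆∪⁅y⁆ : ∀ {u} → Endpoint u → u ∈ ⁅ x ⁆ ∪ ⁅ y ⁆
    endpoint∈⁅x⁆∪⁅y⁆ (inj₁ refl) = i∈⁅i⁆∪⁅j⁆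
    endpoint∈⁅x⁆∪⁅y⁆ (inj₂ refl) = j∈⁅i⁆∪⁅j⁆

    endpoint∈star : ∀ {u w} → Endpoint u → adj G w u ≡ true → u ∈ star w
    endpoint∈star eu e = x∈p∪q⁺ (inj₁ (x∈p∩q⁺ (endpoint∈⁅x⁆∪⁅y⁆ eu , ∈-neighbours⁺ e)))

    centre∈star : ∀ w → w ∈ star w
    centre∈star w = x∈p∪q⁺ (inj₂ (x∈⁅x⁆ w))

    remaining : List (Fin n) → List (Fin n)
    remaining A = filter (λ w → ¬? (w ≟ x)) (filter (λ w → ¬? (w ≟ y)) A)

    endpoint-or-remaining : ∀ {A w} → w ∈ₗ A → Endpoint w ⊎ w ∈ₗ remaining A
    endpoint-or-remaining {A} {w} w∈A with w ≟ x | w ≟ y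
    ... | yes w≡x | _       = inj₁ (inj₁ w≡x)
    ... | no  _   | yes w≡y = inj₁ (inj₂ w≡y)
    ... | no  w≢x | no  w≢y = inj₂ (∈-filter⁺ _ (∈-filter⁺ _ w∈A w≢y) w≢x)

    length-remaining : ∀ {A} → x ∈ₗ A → y ∈ₗ A → 2 + length (remaining A) ≤ length A
    length-remaining {A} x∈A y∈A =
      ≤-trans (s≤s (filter-notAll _ _ (lose (∈-filter⁺ _ x∈A (adj⇒≢ xy)) λ x≢x → x≢x refl)))
              (filter-notAll _ A (lose y∈A λ y≢y → y≢y refl))

    stepCliques : List (Fin n) → List (Subset n) → List (Subset n)
    stepCliques A C = (⁅ x ⁆ ∪ ⁅ y ⁆) ∷ map star (remaining A) ++ C

    stepCliques-cliques : ∀ {A C} → All (IsClique G) C → All (IsClique G) (stepCliques A C)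
    stepCliques-cliques cliques =
      ⁅i⁆∪⁅j⁆-isClique xy ∷ Allₚ.++⁺ (Allₚ.map⁺ (All.universal star-isClique _)) cliques

    length-stepCliques : ∀ A C → length (stepCliques A C) ≡ suc (length (remaining A) + length C)
    length-stepCliques A C = cong suc (trans (length-++ (map star (remaining A)))
                                             (cong (_+ length C) (length-map star (remaining A))))

    stepCliques-covers : ∀ {A C} → CoversEdgesWithin (remaining A) C → CoversEdgesWithin A (stepCliques A C)
    stepCliques-covers {A} covers {u} {v} u∈A v∈A e with endpoint-or-remaining u∈A | endpoint-or-remaining v∈A
    ... | inj₁ eu  | inj₁ ev  = here (endpoint∈⁅x⁆∪⁅y⁆ eu , endpoint∈⁅x⁆∪⁅y⁆ ev)
    ... | inj₁ eu  | inj₂ v∈R =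
      there (Anyₚ.++⁺ˡ (Anyₚ.map⁺ (lose v∈R (endpoint∈star eu (adj-flip e) , centre∈star v))))
    ... | inj₂ u∈R | inj₁ ev  =
      there (Anyₚ.++⁺ˡ (Anyₚ.map⁺ (lose u∈R (centre∈star u , endpoint∈star ev e))))
    ... | inj₂ u∈R | inj₂ v∈R = there (Anyₚ.++⁺ʳ (map star (remaining A)) (covers u∈R v∈R e))

  open ErdősGoodmanPósaStep

  -- s only bounds length A, for the termination checker.
  erdősGoodmanPósa : ∀ {s} A → length A ≤ s →
    ∃ λ C → All (IsClique G) C × length C ≤ quarterSquare (length A) × CoversEdgesWithin A C
  erdősGoodmanPósa A _ with any? (λ u → any? (λ v → adj G u v Bool.≟ true) A) A
  ... | no noEdge = [] , [] , z≤n , λ u∈ v∈ e → contradiction (lose u∈ (lose v∈ e)) noEdge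
  erdősGoodmanPósa {zero} [] _ | yes ()
  erdősGoodmanPósa {suc s} A |A|≤1+s | yes edge
    with x , x∈A , edgeFromX ← find edge
    with y , y∈A , xy ← find edgeFromX
    with C , cliques , |C|≤ , covers ← erdősGoodmanPósa (remaining xy A)
           (s≤s⁻¹ (≤-trans (m≤n+m _ 1) (≤-trans (length-remaining xy x∈A y∈A) |A|≤1+s)))
    = stepCliques xy A C , stepCliques-cliques xy {A} cliques , length≤ , stepCliques-covers xy {A} covers
    where
    r : ℕ
    r = length (remaining xy A)
    length≤ : length (stepCliques xy A C) ≤ quarterSquare (length A)
    length≤ = begin
      length (stepCliques xy A C)   ≡⟨ length-stepCliques xy A C ⟩
      suc (r + length C)             ≤⟨ s≤s (+-monoʳ-≤ r |C|≤) ⟩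
      suc (r + quarterSquare r)      ≡⟨ trans (cong suc (+-comm r _)) (sym (+-suc _ r)) ⟩
      quarterSquare r + suc r        ≡⟨ quarterSquare-suc-suc r ⟨
      quarterSquare (2 + r)          ≤⟨ quarterSquare-mono-≤ (length-remaining xy x∈A y∈A) ⟩
      quarterSquare (length A)       ∎
      where open ≤-Reasoning

  θ≤quarterSquare+isolatedCount : ∀ {k} → θ-is G k → k ≤ quarterSquare nonIsolatedCount + isolatedCount
  θ≤quarterSquare+isolatedCount θ
    with C , cliques , |C|≤ , covers ← erdősGoodmanPósa nonIsolatedVertices ≤-refl
    = θ-is⇒≤ θ (coverable-++isolated cliques (λ e → covers (nonIsolated e) (nonIsolated (adj-flip e)) e) |C|≤)
    where
    nonIsolated : ∀ {i j} → adj G i j ≡ true → i ∈ₗ nonIsolatedVertices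
    nonIsolated e = ∈-filter⁺ (¬? ∘ isolated?) (∈-allFin _) (adj⇒¬isolated e)

module CompleteBipartitePrefix (n p q m : ℕ) (p+q≤n : p + q ≤ n) (m≤p*q : m ≤ p * q) where

  rightDegree : ℕ → ℕ
  rightDegree x = q ⊓ (m ∸ x * q)

  ∑-rightDegree : ∀ m′ p′ → ∑[ x < p′ ] (q ⊓ (m′ ∸ toℕ x * q)) ≡ m′ ⊓ (p′ * q)
  ∑-rightDegree m′ zero     = sym (⊓-zeroʳ m′)
  ∑-rightDegree m′ (suc p′) = begin
    q ⊓ m′ + ∑[ x < p′ ] (q ⊓ (m′ ∸ (q + toℕ x * q)))
      ≡⟨ cong (q ⊓ m′ +_) (sum-cong-≗ {p′} λ x → cong (q ⊓_) (∸-+-assoc m′ q (toℕ x * q))) ⟨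
    q ⊓ m′ + ∑[ x < p′ ] (q ⊓ (m′ ∸ q ∸ toℕ x * q))
      ≡⟨ cong (q ⊓ m′ +_) (∑-rightDegree (m′ ∸ q) p′) ⟩
    q ⊓ m′ + (m′ ∸ q) ⊓ (p′ * q)    ≡⟨ ⊓+∸⊓ q m′ (p′ * q) ⟩
    m′ ⊓ (q + p′ * q)               ∎
    where open ≡-Reasoning

  -- The left vertices x < p are joined to the first rightDegree x right vertices p, p + 1, …,
  -- filling rows of q edges until m edges are used.
  cross : ℕ → ℕ → Bool
  cross x y = (x <ᵇ p) ∧ not (y <ᵇ p) ∧ (y <ᵇ p + rightDegree x)

  cross-irrefl : ∀ x → cross x x ∨ cross x x ≡ false
  cross-irrefl x with x <ᵇ p
  ... | true  = refl
  ... | false = refl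

  H : Graph n
  H = record
    { adj    = λ i j → cross (toℕ i) (toℕ j) ∨ cross (toℕ j) (toℕ i)
    ; sym    = λ i j → ∨-comm (cross (toℕ i) (toℕ j)) _
    ; irrefl = cross-irrefl ∘ toℕ
    }

  adj-crossesSides : ∀ x y → cross x y ∨ cross y x ≡ true → (x <ᵇ p) ≡ not (y <ᵇ p)
  adj-crossesSides x y e with x <ᵇ p | y <ᵇ p
  adj-crossesSides x y () | true  | true
  adj-crossesSides x y () | false | false
  ... | true  | false = refl
  ... | false | true  = refl

  H-triangleFree : TriangleFree H
  H-triangleFree i j k (ij , jk , ik) = not-¬ refl (trans (sym (a≡c)) (adj-crossesSides _ _ ik))
    where
    a≡c : (toℕ i <ᵇ p) ≡ (toℕ k <ᵇ p)
    a≡c = trans (adj-crossesSides _ _ ij) (trans (cong not (adj-crossesSides _ _ jk)) (not-involutive _))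

  cross-upper : ∀ x y → (x <ᵇ y) ∧ (cross x y ∨ cross y x) ≡ cross x y
  cross-upper x y with x <ᵇ p | <ᵇ-reflects-< x p | y <ᵇ p | <ᵇ-reflects-< y p
  ... | true  | _       | true  | _       = ∧-zeroʳ _
  ... | false | _       | false | _       = ∧-zeroʳ _
  ... | true  | ofʸ x<p | false | ofⁿ y≮p =
    trans (cong (λ b → b ∧ ((y <ᵇ p + rightDegree x) ∨ false)) (dec-true (x <? y) (<-≤-trans x<p (≮⇒≥ y≮p))))
          (∨-identityʳ _)
  ... | false | ofⁿ x≮p | true  | ofʸ y<p =
    cong (λ b → b ∧ (x <ᵇ p + rightDegree y)) (dec-false (x <? y) λ x<y → x≮p (<-trans x<y y<p))

  ∑-cross : ∀ x → ∑[ y < n ] [ cross x (toℕ y) ] ≡ (if x <ᵇ p then rightDegree x else 0)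
  ∑-cross x with x <ᵇ p
  ... | true  = ∑-interval p (rightDegree x) (≤-trans (+-monoʳ-≤ p (m⊓n≤m q _)) p+q≤n)
  ... | false = ∑ℕ.sum-replicate-zero n

  H-edgeCount : edgeCount H ≡ m
  H-edgeCount = begin
    edgeCount H
      ≡⟨ sum-map-allFin₂ (λ i j → [ (toℕ i <ᵇ toℕ j) ∧ adj H i j ]) ⟩
    ∑[ i < n ] ∑[ j < n ] [ (toℕ i <ᵇ toℕ j) ∧ adj H i j ]
      ≡⟨ sum-cong-≗ {n} (λ i → sum-cong-≗ {n} λ j → cong [_] (cross-upper (toℕ i) (toℕ j))) ⟩
    ∑[ i < n ] ∑[ j < n ] [ cross (toℕ i) (toℕ j) ]
      ≡⟨ sum-cong-≗ {n} (∑-cross ∘ toℕ) ⟩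
    ∑[ i < n ] (if toℕ i <ᵇ p then rightDegree (toℕ i) else 0)
      ≡⟨ ∑-prefix p rightDegree (≤-trans (m≤m+n p q) p+q≤n) ⟩
    ∑[ x < p ] rightDegree (toℕ x)  ≡⟨ ∑-rightDegree m p ⟩
    m ⊓ (p * q)                     ≡⟨ m≤n⇒m⊓n≡m m≤p*q ⟩
    m                               ∎
    where open ≡-Reasoning

  cross-beyond : ∀ x y → p + q ≤ x → cross x y ∨ cross y x ≡ false
  cross-beyond x y p+q≤x
    with x <ᵇ p | <ᵇ-reflects-< x p | x <ᵇ p + rightDegree y | <ᵇ-reflects-< x (p + rightDegree y)
  ... | true  | ofʸ x<p | _     | _        = contradiction (≤-trans (m≤m+n p q) p+q≤x) (<⇒≱ x<p)
  ... | false | _       | true  | ofʸ x<p+d =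
    contradiction (≤-trans (+-monoʳ-≤ p (m⊓n≤m q _)) p+q≤x) (<⇒≱ x<p+d)
  ... | false | _       | false | _        = ∧-zeroʳ (y <ᵇ p)

  H-isolatedCount : n ≤ isolatedCount H + (p + q)
  H-isolatedCount = begin
    n                                                   ≡⟨ ∑-above+bound (p + q) p+q≤n ⟨
    ∑[ v < n ] [ not (toℕ v <ᵇ p + q) ] + (p + q)       ≤⟨ +-monoˡ-≤ (p + q) (∑-mono-≤ beyond⇒isolated) ⟩
    ∑[ v < n ] [ does (isolated? H v) ] + (p + q)       ≡⟨ cong (_+ (p + q)) (isolatedCount≡∑ H) ⟨
    isolatedCount H + (p + q)                           ∎
    where
    open ≤-Reasoning
    beyond⇒isolated : ∀ v → [ not (toℕ v <ᵇ p + q) ] ≤ [ does (isolated? H v) ]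
    beyond⇒isolated v with toℕ v <ᵇ p + q | <ᵇ-reflects-< (toℕ v) (p + q)
    ... | true  | _        = z≤n
    ... | false | ofⁿ v≮r =
      ≤-reflexive (sym ([does]≡1 (isolated? H v) λ j → cross-beyond (toℕ v) (toℕ j) (≮⇒≥ v≮r)))

extremalGraph : ∀ n r m → r ≤ n → m ≤ quarterSquare r →
  ∃ λ (H : Graph n) → TriangleFree H × edgeCount H ≡ m × n ≤ isolatedCount H + r
extremalGraph n r m r≤n m≤Q = H , H-triangleFree , H-edgeCount ,
  subst (λ r → n ≤ isolatedCount H + r) (⌊n/2⌋+⌈n/2⌉≡n r) H-isolatedCount
  where
  open CompleteBipartitePrefix n ⌊ r /2⌋ ⌈ r /2⌉ m (subst (_≤ n) (sym (⌊n/2⌋+⌈n/2⌉≡n r)) r≤n) m≤Q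

maximal⇒m+n≤k+r : ∀ {n m k r} → ((H : Graph n) (j : ℕ) → edgeCount H ≡ m → θ-is H j → j ≤ k) →
                  r ≤ n → m ≤ quarterSquare r → m + n ≤ k + r
maximal⇒m+n≤k+r {n} {m} {k} {r} maximal r≤n m≤Qr
  with H , H-triangleFree , H-edges , H-isolated ← extremalGraph n r m r≤n m≤Qr = begin
  m + n                          ≤⟨ +-monoʳ-≤ m H-isolated ⟩
  m + (isolatedCount H + r)      ≡⟨ +-assoc m _ r ⟨
  m + isolatedCount H + r        ≤⟨ +-monoˡ-≤ r θ-H≤k ⟩
  k + r                          ∎
  where
  open ≤-Reasoning
  θ-H≤k : m + isolatedCount H ≤ k
  θ-H≤k = subst (λ e → e + isolatedCount H ≤ k) H-edges
                (maximal H _ H-edges (θ-triangleFree H H-triangleFree))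

2+t≤r : ∀ {k m n r t ι} → t + ι ≡ n → k + 2 ≤ m + ι → m + n ≤ k + r → 2 + t ≤ r
2+t≤r {k} {m} {n} {r} {t} {ι} refl k+2≤m+ι m+n≤k+r = +-cancelʳ-≤ (m + ι) (2 + t) r (begin
  2 + t + (m + ι)       ≡⟨ rearrange m t ι ⟩
  m + (t + ι) + 2       ≤⟨ +-monoˡ-≤ 2 m+n≤k+r ⟩
  k + r + 2             ≡⟨ xy∙z≈xz∙y k r 2 ⟩
  k + 2 + r             ≤⟨ +-monoˡ-≤ r k+2≤m+ι ⟩
  m + ι + r             ≡⟨ +-comm (m + ι) r ⟩
  r + (m + ι)           ∎)
  where
  open ≤-Reasoning
  rearrange : ∀ m t ι → 2 + t + (m + ι) ≡ m + (t + ι) + 2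
  rearrange = solve-∀

a+t≤b+u : ∀ {k m n t ι u a b} → t + ι ≡ n → k ≤ b + ι → m + n ≤ k + suc u → a < m → a + t ≤ b + u
a+t≤b+u {k} {m} {n} {t} {ι} {u} {a} {b} refl k≤b+ι m+n≤k+1+u a<m =
  +-cancelʳ-≤ (suc ι) (a + t) (b + u) (begin
    a + t + suc ι         ≡⟨ rearrangeˡ a t ι ⟩
    suc a + (t + ι)       ≤⟨ +-monoˡ-≤ (t + ι) a<m ⟩
    m + (t + ι)           ≤⟨ m+n≤k+1+u ⟩
    k + suc u             ≤⟨ +-monoˡ-≤ (suc u) k≤b+ι ⟩
    b + ι + suc u         ≡⟨ rearrangeʳ b ι u ⟩
    b + u + suc ι         ∎)
  where
  open ≤-Reasoning
  rearrangeˡ : ∀ a t ι → a + t + suc ι ≡ suc a + (t + ι)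
  rearrangeˡ = solve-∀
  rearrangeʳ : ∀ b ι u → b + ι + suc u ≡ b + u + suc ι
  rearrangeʳ = solve-∀

lemma5 : (n m : ℕ) → 4 ≤ n → m ≤ (n * n) / 4 →
    (G : Graph n) → edgeCount G ≡ m →
    (k : ℕ) → θ-is G k →
    ((H : Graph n) (j : ℕ) → edgeCount H ≡ m → θ-is H j → j ≤ k) →
    TriangleFree G
lemma5 n m _ m≤⌊n²/4⌋ G refl k θ maximal i j l ijl
  with triangle ← sortTriangle G ijl
  with r , r≤n , m≤Qr , Q<m-below-r
         ← least-above-quarterSquare n (≤⌊square/4⌋⇒≤quarterSquare n m≤⌊n²/4⌋)
  with m+n≤k+r ← maximal⇒m+n≤k+r maximal r≤n m≤Qr
  with s≤s {n = u} t<u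
         ← 2+t≤r (nonIsolatedCount+isolatedCount G) (θ+2≤edgeCount+isolatedCount G triangle θ) m+n≤k+r
  = <⇒≱ (quarterSquare-outgrows (3≤nonIsolatedCount G triangle) t<u)
        (a+t≤b+u (nonIsolatedCount+isolatedCount G) (θ≤quarterSquare+isolatedCount G θ)
                 m+n≤k+r (Q<m-below-r ≤-refl))
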